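{- Let $k\ge 2$, $n\in\mathbb{N}$ and $w\in S_n$ with Lehmer code $c_w$. Then the number of descents of $\mathcal{C}_{k,n,w}$ is \[D(k,n,w)=\sum_{j\in\operatorname{supp}(c_w)}(k-1)k^{j-1}.\]
   Context: The infinite rooted directed $k$-ary tree has a root on layer $1$; every vertex has $k$ children, ordered left to right, on the next layer. A vertex with at least $k$ chips may fire by choosing $k$ of its labeled chips and sending the $j$th smallest to its $j$th leftmost child. Chips $0,\dots,k^n-1$ start at the root and are written in $n$-digit $k$-ary expansion. For $w\in S_n$, the strategy $F_w$ fires, for each $i\in[n]$, each vertex $v$ on layer $i$ so that all chips on $v$ whose $w_i$th most significant digit equals $j$ go to the $(j+1)$th leftmost child of $v$. $\mathcal{C}_{k,n,w}=(\pi_1,\dots,\pi_{k^n})$ is the resulting stable configuration, read as the sequence of chips on layer $n+1$ from left to right; $D(k,n,w)=\#\{i\in[k^n-1]:\pi_i>\pi_{i+1}\}$. The Lehmer code of $w$ is $c_w$ with $(c_w)_i=\#\{j>i:w_j<w_i\}$, and $\operatorname{supp}(c_w)=\{i\in[n]:(c_w)_i>0\}$. -}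

module Defs where

open import Data.Nat using (ℕ; zero; suc; _+_; _*_; _∸_; _^_; _<ᵇ_; _≡ᵇ_)
open import Data.Nat.DivMod using (_/_; _%_)
open import Data.Bool using (Bool; true; false; if_then_else_)
open import Data.Fin using (Fin; toℕ; _<?_)
open import Data.Fin.Permutation using (Permutation′; _⟨$⟩ʳ_)
open import Data.List using (List; []; _∷_; filter; map; concat; upTo; allFin; length)
open import Data.Nat.ListAction using (sum)
open import Relation.Nullary.Decidable using (⌊_⌋)
open import Data.Nat using (_≟_)
open import Data.Nat.Properties using (m^n≢0)

-- Conventions: positions of a permutation w ∈ S_n are indexed by Fin n
-- (0-based: index i stands for i+1 ∈ [n]), and values likewise
-- (value m stands for m+1).

-- The (m+1)-th most significant digit of x in its n-digit base-k expansion.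
digit : (k n : ℕ) → {{_ : Data.Nat.NonZero k}} → ℕ → Fin n → ℕ
digit k n x m = ((_/_ x (k ^ (n ∸ suc (toℕ m))) {{m^n≢0 k (n ∸ suc (toℕ m))}})) % k

-- One vertex holding a list of chips fires so that chips whose digit
-- (selected by position m) equals j go to the (j+1)-th leftmost child;
-- result: list of the k children's chip lists, left to right.
fireVertex : (k n : ℕ) → {{_ : Data.Nat.NonZero k}} → Fin n → List ℕ → List (List ℕ)
fireVertex k n m chips =
  map (λ j → filter (λ x → digit k n x m ≟ j) chips) (upTo k)

fireLayer : (k n : ℕ) → {{_ : Data.Nat.NonZero k}} → Fin n → List (List ℕ) → List (List ℕ)
fireLayer k n m layer = concat (map (fireVertex k n m) layer)

fireAll : (k n : ℕ) → {{_ : Data.Nat.NonZero k}} → List (Fin n) → List (List ℕ) → List (List ℕ)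
fireAll k n [] layer = layer
fireAll k n (m ∷ ms) layer = fireAll k n ms (fireLayer k n m layer)

finalLayer : (k n : ℕ) → {{_ : Data.Nat.NonZero k}} → Permutation′ n → List (List ℕ)
finalLayer k n w = fireAll k n (map (w ⟨$⟩ʳ_) (allFin n)) ((upTo (k ^ n)) ∷ [])

config : (k n : ℕ) → {{_ : Data.Nat.NonZero k}} → Permutation′ n → List ℕ
config k n w = concat (finalLayer k n w)

descents : List ℕ → ℕ
descents [] = 0
descents (x ∷ []) = 0
descents (x ∷ y ∷ xs) = (if y <ᵇ x then 1 else 0) + descents (y ∷ xs)

D : (k n : ℕ) → {{_ : Data.Nat.NonZero k}} → Permutation′ n → ℕ
D k n w = descents (config k n w)

lehmer : {n : ℕ} → Permutation′ n → Fin n → ℕ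
lehmer {n} w i =
  length (filter (λ j → w ⟨$⟩ʳ j <? w ⟨$⟩ʳ i) (filter (λ j → i <? j) (allFin n)))

-- Σ_{j ∈ supp(c_w)} (k-1) k^{j-1}; with 0-based index i the term is (k-1) k^i.
suppSum : (k : ℕ) → {n : ℕ} → Permutation′ n → ℕ
suppSum k {n} w =
  sum (map (λ i → if lehmer w i ≡ᵇ 0 then 0 else (k ∸ 1) * k ^ toℕ i) (allFin n))

{-# OPTIONS --safe #-}
-- A vertex that still has to fire the positions ms holds exactly the numbers whose digits at
-- the already fired positions are fixed, and the leaves of its subtree list the outputs of its
-- k children block after block. Each block starts with its smallest chip (free digits 0) and
-- ends with its largest (free digits k−1), so the junction between consecutive blocks (digits
-- a < a + 1 at position m) is a descent iff some still free position is more significant than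
-- m, whatever a is. Along F_w the positions still free after firing w_i are w_{i+1}, …, w_n,
-- so this happens iff (c_w)_i > 0. Hence
--   D(w_i … w_n) = k · D(w_{i+1} … w_n) + (k − 1) · [(c_w)_i > 0],
-- which unrolls to the stated sum.
module Submission where

open import Defs
open import Algebra.Properties.CommutativeSemigroup
  using (interchange; x∙yz≈y∙xz)
open import Data.Bool using (Bool; true; false; if_then_else_; not)
open import Data.Bool.Properties using (if-float)
open import Data.Empty using (⊥-elim)
open import Data.Fin using (Fin; zero; suc; toℕ; fromℕ; _<?_)
import Data.Fin.Properties as Finₚ
open import Data.Fin.Permutation
  using (Permutation′; _⟨$⟩ʳ_; _⟨$⟩ˡ_; inverseʳ; inverseˡ)
open import Data.List
  using (List; []; _∷_; [_]; _++_; concat; concatMap; map; filter; tabulate;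
         allFin; upTo; applyUpTo; length; head; last)
open import Data.List.Properties
  using (++-identityʳ; map-id; map-∘; map-cong; map-tabulate; tabulate-cong;
         concat-map; concatMap-++; map-upTo; length-map; filter-++; filter-all;
         filter-none; filter-≐)
open import Data.List.Membership.Propositional using (_∈_; find; lose)
open import Data.List.Membership.Propositional.Properties using (∈-map⁺; ∈-allFin)
open import Data.List.Relation.Unary.All as All using (All)
open import Data.List.Relation.Unary.All.Properties using (tabulate⁺)
import Data.List.Relation.Unary.AllPairs as AllPairs
open import Data.List.Relation.Unary.Any using (here; there; any?)
open import Data.List.Relation.Unary.Unique.Propositional using (Unique)
import Data.List.Relation.Unary.Unique.Propositional.Properties as Unique
open import Data.Maybe using (Maybe; just; nothing; fromMaybe)
open import Data.Nat
  using (ℕ; zero; suc; _+_; _*_; _∸_; _^_; _<ᵇ_; _≡ᵇ_; _≟_; _<_; _≤_; NonZero;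
         z≤n; s≤s; z<s; s<s; s<s⁻¹)
open import Data.Nat.DivMod
  using (_/_; _%_; m*n/n≡m; +-distrib-/-∣ˡ; m<n⇒m/n≡0; m<n⇒m%n≡m; %-remove-+ˡ)
open import Data.Nat.Divisibility using (n∣m*n; m∣m*n; ∣n⇒∣m*n)
open import Data.Nat.ListAction using (sum)
open import Data.Nat.Properties
  using (+-comm; +-assoc; +-identityʳ; *-assoc; *-zeroʳ; *-distribˡ-+; *-monoˡ-≤;
         +-monoʳ-<; m≤m+n; ≤-trans; ≤-reflexive; <⇒≤; ≤⇒≯; <-irrefl;
         <ᵇ-reflects-<; m^n≢0; ^-distribˡ-+-*; m+[n∸m]≡n;
         +-commutativeSemigroup; *-commutativeSemigroup; module ≤-Reasoning)
open import Data.Product using (_,_)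
open import Data.Vec as Vec using (Vec; []; _∷_; lookup; replicate; _[_]≔_)
open import Data.Vec.Properties using (lookup∘update; lookup∘update′; lookup-replicate)
open import Function using (_∘_; id)
open import Level using (Level)
open import Relation.Binary.PropositionalEquality
  using (_≡_; _≢_; refl; sym; trans; cong; cong₂; subst; module ≡-Reasoning)
open import Relation.Nullary using (Dec; does; yes; no; contradiction)
open import Relation.Nullary.Reflects using (ofʸ; ofⁿ)
open import Relation.Unary using (Pred; Decidable; _≐_)

private
  variable
    a p : Level
    A B C : Set a

last-++ : ∀ (xs : List A) y ys → last (xs ++ y ∷ ys) ≡ last (y ∷ ys)
last-++ []            y ys = refl
last-++ (x ∷ [])      y ys = refl
last-++ (x ∷ x′ ∷ xs) y ys = last-++ (x′ ∷ xs) y ys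

concatMap-assoc : ∀ (f : A → List B) (g : B → List C) xs →
  concatMap g (concatMap f xs) ≡ concatMap (concatMap g ∘ f) xs
concatMap-assoc f g []       = refl
concatMap-assoc f g (x ∷ xs) =
  trans (concatMap-++ g (f x) (concatMap f xs)) (cong (concatMap g (f x) ++_) (concatMap-assoc f g xs))

map-concat-tabulate : ∀ {n} (f : A → B) (X : Fin n → List A) →
  map f (concat (tabulate X)) ≡ concat (tabulate (map f ∘ X))
map-concat-tabulate f X = trans (sym (concat-map (tabulate X))) (cong concat (map-tabulate X (map f)))

applyUpTo-+ : ∀ (f : ℕ → A) m n → applyUpTo f (m + n) ≡ applyUpTo f m ++ applyUpTo (f ∘ (m +_)) n
applyUpTo-+ f zero    n = refl
applyUpTo-+ f (suc m) n = cong (f 0 ∷_) (applyUpTo-+ (f ∘ suc) m n)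

applyUpTo≡tabulate : ∀ (f : ℕ → A) n → applyUpTo f n ≡ tabulate {n = n} (f ∘ toℕ)
applyUpTo≡tabulate f zero    = refl
applyUpTo≡tabulate f (suc n) = cong (f 0 ∷_) (applyUpTo≡tabulate (f ∘ suc) n)

upTo-* : ∀ m n → upTo (m * n) ≡ concat (tabulate {n = m} (λ a → map (toℕ a * n +_) (upTo n)))
upTo-* zero    n = refl
upTo-* (suc m) n = begin
    upTo (n + m * n)
  ≡⟨ applyUpTo-+ id n (m * n) ⟩
    upTo n ++ applyUpTo (n +_) (m * n)
  ≡⟨ cong₂ _++_ (map-id (upTo n)) (map-upTo (n +_) (m * n)) ⟨
    map id (upTo n) ++ map (n +_) (upTo (m * n))
  ≡⟨ cong (λ xs → map id (upTo n) ++ map (n +_) xs) (upTo-* m n) ⟩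
    map id (upTo n) ++ map (n +_) (concat (tabulate {n = m} (λ a → map (toℕ a * n +_) (upTo n))))
  ≡⟨ cong (map id (upTo n) ++_) (map-concat-tabulate {n = m} (n +_) (λ a → map (toℕ a * n +_) (upTo n))) ⟩
    map id (upTo n) ++ concat (tabulate {n = m} (λ a → map (n +_) (map (toℕ a * n +_) (upTo n))))
  ≡⟨ cong (λ xss → map id (upTo n) ++ concat xss) (tabulate-cong shift) ⟩
    -- definitional: toℕ zero * n + x reduces to x, and toℕ (suc a) * n to n + toℕ a * n
    concat (tabulate {n = suc m} (λ a → map (toℕ a * n +_) (upTo n))) ∎
  where
  open ≡-Reasoning
  shift : ∀ (a : Fin m) → map (n +_) (map (toℕ a * n +_) (upTo n)) ≡ map ((n + toℕ a * n) +_) (upTo n)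
  shift a = trans (sym (map-∘ (upTo n))) (map-cong (λ x → sym (+-assoc n (toℕ a * n) x)) (upTo n))

module _ {P : Pred A p} (P? : Decidable P) where

  filter-map : ∀ (f : B → A) xs → filter P? (map f xs) ≡ map f (filter (P? ∘ f) xs)
  filter-map f []       = refl
  filter-map f (x ∷ xs) with does (P? (f x))
  ... | true  = cong (f x ∷_) (filter-map f xs)
  ... | false = filter-map f xs

  length-filter-map : ∀ (f : B → A) xs → length (filter P? (map f xs)) ≡ length (filter (P? ∘ f) xs)
  length-filter-map f xs = trans (cong length (filter-map f xs)) (length-map f (filter (P? ∘ f) xs))

  filter-concat-tabulate : ∀ {n} (X : Fin n → List A) →
    filter P? (concat (tabulate X)) ≡ concat (tabulate (filter P? ∘ X))
  filter-concat-tabulate {zero}  X = refl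
  filter-concat-tabulate {suc n} X =
    trans (filter-++ P? (X zero) _) (cong (filter P? (X zero) ++_) (filter-concat-tabulate (X ∘ suc)))

  length-filter≡ᵇ0 : ∀ xs → (length (filter P? xs) ≡ᵇ 0) ≡ not (does (any? P? xs))
  length-filter≡ᵇ0 []       = refl
  length-filter≡ᵇ0 (x ∷ xs) with does (P? x)
  ... | true  = refl
  ... | false = length-filter≡ᵇ0 xs

filter-const : ∀ {Q : Set p} (q? : Dec Q) (xs : List A) → filter (λ _ → q?) xs ≡ (if does q? then xs else [])
filter-const (yes q) xs = filter-all (λ _ → yes q) (All.universal (λ _ → q) xs)
filter-const (no ¬q) xs = filter-none (λ _ → no ¬q) (All.universal (λ _ → ¬q) xs)

concat-tabulate-[] : ∀ n → concat (tabulate {n = n} (λ _ → [])) ≡ [] {A = A}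
concat-tabulate-[] zero    = refl
concat-tabulate-[] (suc n) = concat-tabulate-[] n

concat-tabulate-select : ∀ {n} (X : Fin n → List A) a →
  concat (tabulate (λ b → if toℕ b ≡ᵇ toℕ a then X b else [])) ≡ X a
concat-tabulate-select {n = suc n} X zero    =
  trans (cong (X zero ++_) (concat-tabulate-[] n)) (++-identityʳ (X zero))
concat-tabulate-select {n = suc n} X (suc a) = concat-tabulate-select (X ∘ suc) a

lex-< : ∀ {a b x y N} → x < N → a < b → a * N + x < b * N + y
lex-< {a} {b} {x} {y} {N} x<N a<b = begin-strict
  a * N + x  <⟨ +-monoʳ-< (a * N) x<N ⟩
  a * N + N  ≡⟨ +-comm (a * N) N ⟩
  suc a * N  ≤⟨ *-monoˡ-≤ N a<b ⟩
  b * N      ≤⟨ m≤m+n (b * N) y ⟩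
  b * N + y  ∎
  where open ≤-Reasoning

[m*n+o]/n≡m+o/n : ∀ m n o .{{_ : NonZero n}} → (m * n + o) / n ≡ m + o / n
[m*n+o]/n≡m+o/n m n o = trans (+-distrib-/-∣ˡ o (n∣m*n m)) (cong (_+ o / n) (m*n/n≡m m n))

*-distribˡ-sum : ∀ x ys → x * sum ys ≡ sum (map (x *_) ys)
*-distribˡ-sum x []       = *-zeroʳ x
*-distribˡ-sum x (y ∷ ys) = trans (*-distribˡ-+ x y (sum ys)) (cong (x * y +_) (*-distribˡ-sum x ys))

indicator : Bool → ℕ
indicator b = if b then 1 else 0

*-indicator : ∀ x b → x * indicator b ≡ (if not b then 0 else x * 1)
*-indicator x true  = refl
*-indicator x false = *-zeroʳ x

*-if : ∀ x b y → x * (if b then 0 else y) ≡ (if b then 0 else x * y)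
*-if x true  y = *-zeroʳ x
*-if x false y = refl

descentAt : ℕ → ℕ → ℕ
descentAt x y = indicator (y <ᵇ x)

descentAt-< : ∀ {x y} → y < x → descentAt x y ≡ 1
descentAt-< {x} {y} y<x with y <ᵇ x | <ᵇ-reflects-< y x
... | true  | _        = refl
... | false | ofⁿ y≮x = contradiction y<x y≮x

descentAt-≤ : ∀ {x y} → x ≤ y → descentAt x y ≡ 0
descentAt-≤ {x} {y} x≤y with y <ᵇ x | <ᵇ-reflects-< y x
... | true  | ofʸ y<x = contradiction y<x (≤⇒≯ x≤y)
... | false | _        = refl

descents-++ : ∀ {l} xs y ys → last xs ≡ just l →
  descents (xs ++ y ∷ ys) ≡ descents xs + descentAt l y + descents (y ∷ ys)
descents-++ []            y ys ()
descents-++ (x ∷ [])      y ys refl = refl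
descents-++ {l} (x ∷ x′ ∷ xs) y ys eq = begin
    descentAt x x′ + descents ((x′ ∷ xs) ++ y ∷ ys)
  ≡⟨ cong (descentAt x x′ +_) (descents-++ (x′ ∷ xs) y ys eq) ⟩
    descentAt x x′ + (descents (x′ ∷ xs) + descentAt l y + descents (y ∷ ys))
  ≡⟨ +-assoc (descentAt x x′) _ _ ⟨
    descentAt x x′ + (descents (x′ ∷ xs) + descentAt l y) + descents (y ∷ ys)
  ≡⟨ cong (_+ descents (y ∷ ys)) (+-assoc (descentAt x x′) _ _) ⟨
    descents (x ∷ x′ ∷ xs) + descentAt l y + descents (y ∷ ys) ∎
  where open ≡-Reasoning

record Profile (xs : List ℕ) (first final d : ℕ) : Set where
  constructor profile
  field
    head≡     : head xs ≡ just first
    last≡     : last xs ≡ just final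
    descents≡ : descents xs ≡ d

Profile-resp : ∀ {xs ys f f′ l l′ d d′} → xs ≡ ys → f ≡ f′ → l ≡ l′ → d ≡ d′ →
  Profile xs f l d → Profile ys f′ l′ d′
Profile-resp refl refl refl refl prf = prf

profile-++ : ∀ {xs ys f l d f′ l′ d′} → Profile xs f l d → Profile ys f′ l′ d′ →
  Profile (xs ++ ys) f l′ (d + descentAt l f′ + d′)
profile-++ {[]}              (profile () _ _) _
profile-++ {x ∷ xs} {[]}     _ (profile () _ _)
profile-++ {x ∷ xs} {y ∷ ys} {l = l} (profile refl lastx dx) (profile refl lasty dy) =
  profile refl
    (trans (last-++ (x ∷ xs) y ys) lasty)
    (trans (descents-++ (x ∷ xs) y ys lastx) (cong₂ (λ u v → u + descentAt l y + v) dx dy))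

concat-profile : ∀ {K d c} (B : Fin (suc K) → List ℕ) (F L : Fin (suc K) → ℕ) →
  (∀ a → Profile (B a) (F a) (L a) d) →
  (∀ a b → toℕ a < toℕ b → descentAt (L a) (F b) ≡ c) →
  Profile (concat (tabulate B)) (F zero) (L (fromℕ K)) (suc K * d + K * c)
concat-profile {zero} {d} B F L blocks _ =
  Profile-resp (sym (++-identityʳ (B zero))) refl refl
    (sym (trans (+-identityʳ _) (+-identityʳ d))) (blocks zero)
concat-profile {suc K} {d} {c} B F L blocks boundary =
  Profile-resp refl refl refl descents≡
    (profile-++ (blocks zero)
      (concat-profile (B ∘ suc) (F ∘ suc) (L ∘ suc) (blocks ∘ suc)
        (λ a b a<b → boundary (suc a) (suc b) (s<s a<b))))
  where
  descents≡ : d + descentAt (L zero) (F (suc zero)) + (suc K * d + K * c)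
            ≡ suc (suc K) * d + suc K * c
  descents≡ = trans (cong (λ e → d + e + (suc K * d + K * c)) (boundary zero (suc zero) z<s))
                    (interchange +-commutativeSemigroup d c (suc K * d) (K * c))

-- Defs.lehmer w is definitionally lehmerCode (w ⟨$⟩ʳ_); allowing arbitrary sequences makes
-- it amenable to induction on their length.
lehmerCode : ∀ {m n} → (Fin m → Fin n) → Fin m → ℕ
lehmerCode {m} f i = length (filter (λ j → f j <? f i) (filter (λ j → i <? j) (allFin m)))

lehmerCode-zero : ∀ {m n} (f : Fin (suc m) → Fin n) →
  lehmerCode f zero ≡ length (filter (_<? f zero) (tabulate (f ∘ suc)))
lehmerCode-zero {m} f = begin
    length (filter (λ j → f j <? f zero) (filter (zero {n = m} <?_) (tabulate suc)))
  ≡⟨ cong (length ∘ filter (λ j → f j <? f zero))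
          (filter-all (zero {n = m} <?_) (tabulate⁺ {f = suc} (λ _ → z<s))) ⟩
    length (filter (λ j → f j <? f zero) (tabulate {n = m} suc))
  ≡⟨ length-filter-map (_<? f zero) f (tabulate suc) ⟨
    length (filter (_<? f zero) (map f (tabulate {n = m} suc)))
  ≡⟨ cong (length ∘ filter (_<? f zero)) (map-tabulate suc f) ⟩
    length (filter (_<? f zero) (tabulate (f ∘ suc))) ∎
  where open ≡-Reasoning

lehmerCode-suc : ∀ {m n} (f : Fin (suc m) → Fin n) i → lehmerCode f (suc i) ≡ lehmerCode (f ∘ suc) i
lehmerCode-suc {m} f i = begin
    length (filter (λ j → f j <? f (suc i)) (filter (suc i <?_) (tabulate {n = m} suc)))
  ≡⟨ cong (length ∘ filter (λ j → f j <? f (suc i))) later ⟩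
    length (filter (λ j → f j <? f (suc i)) (map suc (filter (i <?_) (allFin m))))
  ≡⟨ length-filter-map (λ j → f j <? f (suc i)) suc (filter (i <?_) (allFin m)) ⟩
    lehmerCode (f ∘ suc) i ∎
  where
  open ≡-Reasoning
  later : filter (suc i <?_) (tabulate {n = m} suc) ≡ map suc (filter (i <?_) (allFin m))
  later = begin
      filter (suc i <?_) (tabulate {n = m} suc)
    ≡⟨ cong (filter (suc i <?_)) (map-tabulate id suc) ⟨
      filter (suc i <?_) (map suc (allFin m))
    ≡⟨ filter-map (suc i <?_) suc (allFin m) ⟩
      map suc (filter (λ j → suc i <? suc j) (allFin m))
    ≡⟨ cong (map suc) (filter-≐ (λ j → suc i <? suc j) (i <?_) (s<s⁻¹ , s<s) (allFin m)) ⟩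
      map suc (filter (i <?_) (allFin m)) ∎

module Radix (K : ℕ) where

  k : ℕ
  k = suc K

  fromDigits : ∀ {n} → Vec (Fin k) n → ℕ
  fromDigits []               = 0
  fromDigits {suc n} (a ∷ ds) = toℕ a * k ^ n + fromDigits ds

  fromDigits<k^n : ∀ {n} (ds : Vec (Fin k) n) → fromDigits ds < k ^ n
  fromDigits<k^n []               = z<s
  fromDigits<k^n {suc n} (a ∷ ds) =
    ≤-trans (lex-< {y = 0} (fromDigits<k^n ds) (Finₚ.toℕ<n a)) (≤-reflexive (+-identityʳ _))

  digit-fromDigits : ∀ {n} (ds : Vec (Fin k) n) m → digit k n (fromDigits ds) m ≡ toℕ (lookup ds m)
  digit-fromDigits {suc n} (a ∷ ds) zero = begin
      (toℕ a * k ^ n + fromDigits ds) / k ^ n % k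
    ≡⟨ cong (_% k) ([m*n+o]/n≡m+o/n (toℕ a) (k ^ n) _) ⟩
      (toℕ a + fromDigits ds / k ^ n) % k
    ≡⟨ cong (λ q → (toℕ a + q) % k) (m<n⇒m/n≡0 (fromDigits<k^n ds)) ⟩
      (toℕ a + 0) % k
    ≡⟨ cong (_% k) (+-identityʳ (toℕ a)) ⟩
      toℕ a % k
    ≡⟨ m<n⇒m%n≡m (Finₚ.toℕ<n a) ⟩
      toℕ a ∎
    where
    open ≡-Reasoning
    instance
      k^n≢0 : NonZero (k ^ n)
      k^n≢0 = m^n≢0 k n
  digit-fromDigits {suc n} (a ∷ ds) (suc m) = begin
      (toℕ a * k ^ n + v) / k ^ e % k
    ≡⟨ cong (λ N → (toℕ a * N + v) / k ^ e % k) k^n≡ ⟩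
      (toℕ a * (k ^ suc t * k ^ e) + v) / k ^ e % k
    ≡⟨ cong (λ x → (x + v) / k ^ e % k) (*-assoc (toℕ a) (k ^ suc t) (k ^ e)) ⟨
      (toℕ a * k ^ suc t * k ^ e + v) / k ^ e % k
    ≡⟨ cong (_% k) ([m*n+o]/n≡m+o/n (toℕ a * k ^ suc t) (k ^ e) v) ⟩
      (toℕ a * k ^ suc t + v / k ^ e) % k
    ≡⟨ %-remove-+ˡ (v / k ^ e) (∣n⇒∣m*n (toℕ a) (m∣m*n (k ^ t))) ⟩
      v / k ^ e % k
    ≡⟨ digit-fromDigits ds m ⟩
      toℕ (lookup ds m) ∎
    where
    open ≡-Reasoning
    v t e : ℕ
    v = fromDigits ds
    t = toℕ m
    e = n ∸ suc t
    instance
      k^e≢0 : NonZero (k ^ e)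
      k^e≢0 = m^n≢0 k e
    k^n≡ : k ^ n ≡ k ^ suc t * k ^ e
    k^n≡ = trans (cong (k ^_) (sym (m+[n∸m]≡n (Finₚ.toℕ<n m)))) (^-distribˡ-+-* k (suc t) e)

  -- Digits fixed by the firings so far are just, free ones nothing; completions lists the
  -- matching digit vectors in the left-to-right order of the leaves.
  Pattern : ℕ → Set
  Pattern = Vec (Maybe (Fin k))

  completions : ∀ {n} → Pattern n → List (Vec (Fin k) n)
  completions []            = [ [] ]
  completions (just a ∷ P)  = map (a ∷_) (completions P)
  completions (nothing ∷ P) = concat (tabulate (λ a → map (a ∷_) (completions P)))

  fill : ∀ {n} → Fin k → Pattern n → Vec (Fin k) n
  fill d = Vec.map (fromMaybe d)

  chips : ∀ {n} → Pattern n → List ℕ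
  chips P = map fromDigits (completions P)

  minChip maxChip : ∀ {n} → Pattern n → ℕ
  minChip P = fromDigits (fill zero P)
  maxChip P = fromDigits (fill (fromℕ K) P)

  fill-update : ∀ {n} d (P : Pattern n) m → lookup P m ≡ nothing → fill d (P [ m ]≔ just d) ≡ fill d P
  fill-update d (nothing ∷ P) zero    _ = refl
  fill-update d (just _ ∷ P)  zero    ()
  fill-update d (c ∷ P)       (suc m) e = cong (fromMaybe d c ∷_) (fill-update d P m e)

  completions-total : ∀ {n} (P : Pattern n) → (∀ p → lookup P p ≢ nothing) →
    ∀ d → completions P ≡ [ fill d P ]
  completions-total []            _     d = refl
  completions-total (nothing ∷ P) fixed d = ⊥-elim (fixed zero refl)
  completions-total (just a ∷ P)  fixed d = cong (map (a ∷_)) (completions-total P (fixed ∘ suc) d)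

  filter-completions : ∀ {n} (P : Pattern n) m a → lookup P m ≡ nothing →
    filter (λ ds → toℕ (lookup ds m) ≟ toℕ a) (completions P) ≡ completions (P [ m ]≔ just a)
  filter-completions (just c ∷ P)  zero    a ()
  filter-completions {suc n} (nothing ∷ P) zero a _ = begin
      filter digit≟ (concat (tabulate (λ b → map (b ∷_) (completions P))))
    ≡⟨ filter-concat-tabulate digit≟ (λ b → map (b ∷_) (completions P)) ⟩
      concat (tabulate (λ b → filter digit≟ (map (b ∷_) (completions P))))
    ≡⟨ cong concat (tabulate-cong block) ⟩
      concat (tabulate (λ b → if toℕ b ≡ᵇ toℕ a then map (b ∷_) (completions P) else []))
    ≡⟨ concat-tabulate-select (λ b → map (b ∷_) (completions P)) a ⟩
      map (a ∷_) (completions P) ∎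
    where
    open ≡-Reasoning
    digit≟ : (ds : Vec (Fin k) (suc n)) → Dec (toℕ (lookup ds zero) ≡ toℕ a)
    digit≟ ds = toℕ (lookup ds zero) ≟ toℕ a
    block : ∀ b → filter digit≟ (map (b ∷_) (completions P))
                ≡ (if toℕ b ≡ᵇ toℕ a then map (b ∷_) (completions P) else [])
    block b = begin
        filter digit≟ (map (b ∷_) (completions P))
      ≡⟨ filter-map digit≟ (b ∷_) (completions P) ⟩
        map (b ∷_) (filter (λ _ → toℕ b ≟ toℕ a) (completions P))
      ≡⟨ cong (map (b ∷_)) (filter-const (toℕ b ≟ toℕ a) (completions P)) ⟩
        map (b ∷_) (if toℕ b ≡ᵇ toℕ a then completions P else [])
      ≡⟨ if-float (map (b ∷_)) (toℕ b ≡ᵇ toℕ a) ⟩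
        (if toℕ b ≡ᵇ toℕ a then map (b ∷_) (completions P) else []) ∎
  filter-completions {suc n} (nothing ∷ P) (suc m) a e =
    trans (filter-concat-tabulate digit≟ (λ b → map (b ∷_) (completions P)))
      (cong concat (tabulate-cong λ b →
        trans (filter-map digit≟ (b ∷_) (completions P)) (cong (map (b ∷_)) (filter-completions P m a e))))
    where
    digit≟ : (ds : Vec (Fin k) (suc n)) → Dec (toℕ (lookup ds (suc m)) ≡ toℕ a)
    digit≟ ds = toℕ (lookup ds (suc m)) ≟ toℕ a
  filter-completions (just c ∷ P)  (suc m) a e =
    trans (filter-map (λ ds → toℕ (lookup ds (suc m)) ≟ toℕ a) (c ∷_) (completions P))
      (cong (map (c ∷_)) (filter-completions P m a e))

  fireVertex-chips : ∀ {n} (P : Pattern n) m → lookup P m ≡ nothing →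
    fireVertex k n m (chips P) ≡ tabulate (λ a → chips (P [ m ]≔ just a))
  fireVertex-chips {n} P m free = begin
      map (λ j → filter (λ x → digit k n x m ≟ j) (chips P)) (upTo k)
    ≡⟨ trans (map-upTo child k) (applyUpTo≡tabulate child k) ⟩
      tabulate (λ a → filter (λ x → digit k n x m ≟ toℕ a) (chips P))
    ≡⟨ tabulate-cong block ⟩
      tabulate (λ a → chips (P [ m ]≔ just a)) ∎
    where
    open ≡-Reasoning
    child : ℕ → List ℕ
    child j = filter (λ x → digit k n x m ≟ j) (chips P)
    block : ∀ a → filter (λ x → digit k n x m ≟ toℕ a) (chips P) ≡ chips (P [ m ]≔ just a)
    block a = begin
        filter (λ x → digit k n x m ≟ toℕ a) (map fromDigits (completions P))
      ≡⟨ filter-map (λ x → digit k n x m ≟ toℕ a) fromDigits (completions P) ⟩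
        map fromDigits (filter (λ ds → digit k n (fromDigits ds) m ≟ toℕ a) (completions P))
      ≡⟨ cong (map fromDigits) (filter-≐ (λ ds → digit k n (fromDigits ds) m ≟ toℕ a)
                                         (λ ds → toℕ (lookup ds m) ≟ toℕ a) digit≐ (completions P)) ⟩
        map fromDigits (filter (λ ds → toℕ (lookup ds m) ≟ toℕ a) (completions P))
      ≡⟨ cong (map fromDigits) (filter-completions P m a free) ⟩
        chips (P [ m ]≔ just a) ∎
      where
      digit≐ : (λ ds → digit k n (fromDigits ds) m ≡ toℕ a) ≐ (λ ds → toℕ (lookup ds m) ≡ toℕ a)
      digit≐ = (λ {ds} → subst (_≡ toℕ a) (digit-fromDigits ds m))
             , (λ {ds} → subst (_≡ toℕ a) (sym (digit-fromDigits ds m)))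

  chips-allFree : ∀ n → chips (replicate n nothing) ≡ upTo (k ^ n)
  chips-allFree zero    = refl
  chips-allFree (suc n) = begin
      map fromDigits (concat (tabulate (λ a → map (a ∷_) (completions R))))
    ≡⟨ map-concat-tabulate fromDigits (λ a → map (a ∷_) (completions R)) ⟩
      concat (tabulate (λ a → map fromDigits (map (a ∷_) (completions R))))
    ≡⟨ cong concat (tabulate-cong block) ⟩
      concat (tabulate {n = k} (λ a → map (toℕ a * k ^ n +_) (upTo (k ^ n))))
    ≡⟨ upTo-* k (k ^ n) ⟨
      upTo (k ^ suc n) ∎
    where
    open ≡-Reasoning
    R : Pattern n
    R = replicate n nothing
    block : ∀ a → map fromDigits (map (a ∷_) (completions R)) ≡ map (toℕ a * k ^ n +_) (upTo (k ^ n))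
    block a = begin
        map fromDigits (map (a ∷_) (completions R))
      ≡⟨ map-∘ (completions R) ⟨
        map (λ ds → toℕ a * k ^ n + fromDigits ds) (completions R)
      ≡⟨ map-∘ (completions R) ⟩
        map (toℕ a * k ^ n +_) (chips R)
      ≡⟨ cong (map (toℕ a * k ^ n +_)) (chips-allFree n) ⟩
        map (toℕ a * k ^ n +_) (upTo (k ^ n)) ∎

  record FreePositions {n} (P : Pattern n) (ms : List (Fin n)) : Set where
    field
      free⇒∈   : ∀ {p} → lookup P p ≡ nothing → p ∈ ms
      ∈⇒free   : ∀ {p} → p ∈ ms → lookup P p ≡ nothing
      distinct : Unique ms

  FreePositions-fix : ∀ {n} {P : Pattern n} {m ms} a →
    FreePositions P (m ∷ ms) → FreePositions (P [ m ]≔ just a) ms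
  FreePositions-fix {P = P} {m} {ms} a free = record
    { free⇒∈   = free⇒∈′
    ; ∈⇒free   = λ p∈ms → trans (update≢ (m∉ms p∈ms)) (∈⇒free (there p∈ms))
    ; distinct = AllPairs.tail distinct
    }
    where
    open FreePositions free
    m∉ms : ∀ {p} → p ∈ ms → p ≢ m
    m∉ms p∈ms p≡m = All.lookup (AllPairs.head distinct) p∈ms (sym p≡m)
    update≢ : ∀ {p} → p ≢ m → lookup (P [ m ]≔ just a) p ≡ lookup P p
    update≢ p≢m = lookup∘update′ p≢m P (just a)
    free⇒∈′ : ∀ {p} → lookup (P [ m ]≔ just a) p ≡ nothing → p ∈ ms
    free⇒∈′ {p} e with p Finₚ.≟ m
    ... | yes refl = contradiction (trans (sym (lookup∘update m P (just a))) e) λ ()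
    ... | no p≢m with free⇒∈ (trans (sym (update≢ p≢m)) e)
    ...   | here p≡m   = contradiction p≡m p≢m
    ...   | there p∈ms = p∈ms

  FreePositions-permutation : ∀ {n} (w : Permutation′ n) →
    FreePositions (replicate n nothing) (map (w ⟨$⟩ʳ_) (allFin n))
  FreePositions-permutation {n} w = record
    { free⇒∈   = λ {p} _ → subst (_∈ map (w ⟨$⟩ʳ_) (allFin n)) (inverseʳ w)
                                   (∈-map⁺ (w ⟨$⟩ʳ_) (∈-allFin (w ⟨$⟩ˡ p)))
    ; ∈⇒free   = λ {p} _ → lookup-replicate p nothing
    ; distinct = Unique.map⁺ injective (Unique.allFin⁺ n)
    }
    where
    injective : ∀ {i j} → w ⟨$⟩ʳ i ≡ w ⟨$⟩ʳ j → i ≡ j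
    injective {i} {j} eq = trans (sym (inverseˡ w)) (trans (cong (w ⟨$⟩ˡ_) eq) (inverseˡ w))

  fixedBefore⇒maxChip<minChip : ∀ {n} (P : Pattern n) m {a b} →
    (∀ p → toℕ p < toℕ m → lookup P p ≢ nothing) → toℕ a < toℕ b →
    maxChip (P [ m ]≔ just a) < minChip (P [ m ]≔ just b)
  fixedBefore⇒maxChip<minChip (_ ∷ P)       zero    _     a<b =
    lex-< (fromDigits<k^n (fill (fromℕ K) P)) a<b
  fixedBefore⇒maxChip<minChip (nothing ∷ P) (suc m) fixed a<b = ⊥-elim (fixed zero z<s refl)
  fixedBefore⇒maxChip<minChip {suc n} (just c ∷ P) (suc m) fixed a<b =
    +-monoʳ-< (toℕ c * k ^ n) (fixedBefore⇒maxChip<minChip P m (λ p p<m → fixed (suc p) (s<s p<m)) a<b)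

  freeBefore⇒minChip<maxChip : ∀ {n} (P : Pattern n) m p {a b} →
    lookup P p ≡ nothing → toℕ p < toℕ m → toℕ a < toℕ b →
    minChip (P [ m ]≔ just b) < maxChip (P [ m ]≔ just a)
  freeBefore⇒minChip<maxChip (nothing ∷ P) (suc m) p {a} {b} _ _ a<b =
    lex-< (fromDigits<k^n (fill zero (P [ m ]≔ just b)))
          (≤-trans (s≤s z≤n) (≤-trans a<b (Finₚ.≤fromℕ b)))
  freeBefore⇒minChip<maxChip (just c ∷ P) (suc m) zero    () _ _
  freeBefore⇒minChip<maxChip {suc n} (just c ∷ P) (suc m) (suc p) free p<m a<b =
    +-monoʳ-< (toℕ c * k ^ n) (freeBefore⇒minChip<maxChip P m p free (s<s⁻¹ p<m) a<b)

  boundary-descent : ∀ {n} {P : Pattern n} {m ms} {a b : Fin k} →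
    FreePositions P (m ∷ ms) → toℕ a < toℕ b →
    descentAt (maxChip (P [ m ]≔ just a)) (minChip (P [ m ]≔ just b))
      ≡ indicator (does (any? (_<? m) ms))
  boundary-descent {P = P} {m} {ms} free a<b with any? (_<? m) ms
  ... | yes below =
    let p , p∈ms , p<m = find below
    in descentAt-< (freeBefore⇒minChip<maxChip P m p (FreePositions.∈⇒free free (there p∈ms)) p<m a<b)
  ... | no ¬below = descentAt-≤ (<⇒≤ (fixedBefore⇒maxChip<minChip P m fixed a<b))
    where
    fixed : ∀ p → toℕ p < toℕ m → lookup P p ≢ nothing
    fixed p p<m p-free with FreePositions.free⇒∈ free p-free
    ... | here refl  = <-irrefl refl p<m
    ... | there p∈ms = ¬below (lose p∈ms p<m)

  fireFrom : ∀ {n} → List (Fin n) → List ℕ → List ℕ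
  fireFrom     []       xs = xs
  fireFrom {n} (m ∷ ms) xs = concatMap (fireFrom ms) (fireVertex k n m xs)

  concat-fireAll : ∀ {n} (ms : List (Fin n)) layer →
    concat (fireAll k n ms layer) ≡ concatMap (fireFrom ms) layer
  concat-fireAll     []       layer = cong concat (sym (map-id layer))
  concat-fireAll {n} (m ∷ ms) layer =
    trans (concat-fireAll ms (fireLayer k n m layer)) (concatMap-assoc (fireVertex k n m) (fireFrom ms) layer)

  descentCount : ∀ {n} → List (Fin n) → ℕ
  descentCount []       = 0
  descentCount (m ∷ ms) = k * descentCount ms + K * indicator (does (any? (_<? m) ms))

  fireFrom-profile : ∀ {n} ms (P : Pattern n) → FreePositions P ms →
    Profile (fireFrom ms (chips P)) (minChip P) (maxChip P) (descentCount ms)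
  fireFrom-profile [] P free = profile
      (cong (head ∘ map fromDigits) (completions-total P fixed zero))
      (cong (last ∘ map fromDigits) (completions-total P fixed (fromℕ K)))
      (cong (descents ∘ map fromDigits) (completions-total P fixed zero))
    where
    fixed : ∀ p → lookup P p ≢ nothing
    fixed p p-free = contradiction (FreePositions.free⇒∈ free p-free) λ ()
  fireFrom-profile {n} (m ∷ ms) P free =
    Profile-resp (sym split) (cong fromDigits (fill-update zero P m m-free))
      (cong fromDigits (fill-update (fromℕ K) P m m-free)) refl
      (concat-profile (λ a → fireFrom ms (chips (P′ a))) (minChip ∘ P′) (maxChip ∘ P′)
        (λ a → fireFrom-profile ms (P′ a) (FreePositions-fix a free))
        (λ a b a<b → boundary-descent free a<b))
    where
    P′ : Fin k → Pattern n
    P′ a = P [ m ]≔ just a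
    m-free : lookup P m ≡ nothing
    m-free = FreePositions.∈⇒free free (here refl)
    split : fireFrom (m ∷ ms) (chips P) ≡ concat (tabulate (λ a → fireFrom ms (chips (P′ a))))
    split = cong concat (trans (cong (map (fireFrom ms)) (fireVertex-chips P m m-free))
                               (map-tabulate (chips ∘ P′) (fireFrom ms)))

  suppTerm : ∀ {m n} → (Fin m → Fin n) → Fin m → ℕ
  suppTerm f i = if lehmerCode f i ≡ᵇ 0 then 0 else K * k ^ toℕ i

  descentCount-tabulate : ∀ {m n} (f : Fin m → Fin n) →
    descentCount (tabulate f) ≡ sum (tabulate (suppTerm f))
  descentCount-tabulate {zero}  f = refl
  descentCount-tabulate {suc m} f = begin
      k * descentCount (tabulate (f ∘ suc)) + K * indicator b
    ≡⟨ +-comm _ (K * indicator b) ⟩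
      K * indicator b + k * descentCount (tabulate (f ∘ suc))
    ≡⟨ cong₂ _+_ first-term (cong (k *_) (descentCount-tabulate (f ∘ suc))) ⟩
      suppTerm f zero + k * sum (tabulate (suppTerm (f ∘ suc)))
    ≡⟨ cong (suppTerm f zero +_) (*-distribˡ-sum k (tabulate (suppTerm (f ∘ suc)))) ⟩
      suppTerm f zero + sum (map (k *_) (tabulate (suppTerm (f ∘ suc))))
    ≡⟨ cong (λ xs → suppTerm f zero + sum xs)
            (trans (map-tabulate (suppTerm (f ∘ suc)) (k *_)) (tabulate-cong later-term)) ⟩
      suppTerm f zero + sum (tabulate (suppTerm f ∘ suc)) ∎
    where
    open ≡-Reasoning
    b : Bool
    b = does (any? (_<? f zero) (tabulate (f ∘ suc)))
    first-term : K * indicator b ≡ suppTerm f zero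
    first-term = begin
        K * indicator b
      ≡⟨ *-indicator K b ⟩
        (if not b then 0 else K * 1)
      ≡⟨ cong (λ c → if c then 0 else K * 1)
           (trans (cong (_≡ᵇ 0) (lehmerCode-zero f))
                  (length-filter≡ᵇ0 (_<? f zero) (tabulate (f ∘ suc)))) ⟨
        suppTerm f zero ∎
    later-term : ∀ i → k * suppTerm (f ∘ suc) i ≡ suppTerm f (suc i)
    later-term i = begin
        k * suppTerm (f ∘ suc) i
      ≡⟨ *-if k (c ≡ᵇ 0) (K * k ^ toℕ i) ⟩
        (if c ≡ᵇ 0 then 0 else k * (K * k ^ toℕ i))
      ≡⟨ cong (λ x → if c ≡ᵇ 0 then 0 else x) (x∙yz≈y∙xz *-commutativeSemigroup k K (k ^ toℕ i)) ⟩
        (if c ≡ᵇ 0 then 0 else K * k ^ suc (toℕ i))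
      ≡⟨ cong (λ c → if c ≡ᵇ 0 then 0 else K * k ^ suc (toℕ i)) (lehmerCode-suc f i) ⟨
        suppTerm f (suc i) ∎
      where
      c : ℕ
      c = lehmerCode (f ∘ suc) i

theorem5p3 : (k' n : ℕ) → (w : Permutation′ n) →
    D (suc (suc k')) n w ≡ suppSum (suc (suc k')) w
theorem5p3 k' n w = begin
    descents (concat (fireAll k n ws [ upTo (k ^ n) ]))
  ≡⟨ cong descents (trans (concat-fireAll ws [ upTo (k ^ n) ]) (++-identityʳ _)) ⟩
    descents (fireFrom ws (upTo (k ^ n)))
  ≡⟨ cong (descents ∘ fireFrom ws) (chips-allFree n) ⟨
    descents (fireFrom ws (chips (replicate n nothing)))
  ≡⟨ Profile.descents≡ (fireFrom-profile ws (replicate n nothing) (FreePositions-permutation w)) ⟩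
    descentCount ws
  ≡⟨ cong descentCount (map-tabulate id (w ⟨$⟩ʳ_)) ⟩
    descentCount (tabulate (w ⟨$⟩ʳ_))
  ≡⟨ descentCount-tabulate (w ⟨$⟩ʳ_) ⟩
    sum (tabulate (suppTerm (w ⟨$⟩ʳ_)))
  ≡⟨ cong sum (map-tabulate id (suppTerm (w ⟨$⟩ʳ_))) ⟨
    suppSum k w ∎
  where
  open ≡-Reasoning
  open Radix (suc k')
  ws : List (Fin n)
  ws = map (w ⟨$⟩ʳ_) (allFin n)
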